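{- Let ${\sf TQ}$ be the theory in the language $\{<,\times,{}^{ -1},\mathbf{1}\}$ with axioms: (O1) $\forall x,y\,(x<y\rightarrow y\not<x)$; (O2) $\forall x,y,z\,(x<y<z\rightarrow x<z)$; (O3) $\forall x,y\,(x<y\vee x=y\vee y<x)$; (M1) $\forall x,y,z\,(x\cdot(y\cdot z)=(x\cdot y)\cdot z)$; (M2) $\forall x\,(x\cdot\mathbf{1}=x)$; (M3) $\forall x\,(x\cdot x^{ -1}=\mathbf{1})$; (M4) $\forall x,y\,(x\cdot y=y\cdot x)$; (M5) $\forall x,y,z\,(x<y\rightarrow x\cdot z<y\cdot z)$; (M6) $\exists y\,(y\neq\mathbf{1})$; (M10) for each $n\geq1$: $\forall x,z\,\exists y\,(x<z\rightarrow x<y^n<z)$; (M11) for each $n\geq1$, $q\geq1$ and integers $m_0,\dots,m_{q-1}>1$: $\forall x_0,\dots,x_{q-1}\,\exists y\,\forall z\,\bigwedge_{j<q,\ m_j\nmid n}(y^n\cdot x_j\neq z^{m_j})$. Then for every $n>1$ the following sentences are provable in ${\sf TQ}$: $\forall u\,\exists y\,[\Re_n(y\cdot u)]$; $\forall x,u\,\exists y\,[x<y\wedge\Re_n(y\cdot u)]$; $\forall z,u\,\exists y\,[y<z\wedge\Re_n(y\cdot u)]$; $\forall x,z,u\,\exists y\,[x<z\rightarrow x<y<z\wedge\Re_n(y\cdot u)]$.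
   Context: $y^n$ is the $n$-fold product; $\Re_n(w)$ abbreviates the formula $\exists v\,(w=v^n)$. An empty conjunction is true. -}

module Defs where

open import Data.Nat using (ℕ; zero; suc) renaming (_<_ to _<ℕ_)
open import Data.Nat.Divisibility using (_∣_)
open import Data.Fin using (Fin)
open import Data.Product using (∃-syntax; _×_)
open import Data.Sum using (_⊎_)
open import Relation.Binary.PropositionalEquality using (_≡_; _≢_)
open import Relation.Nullary using (¬_)

pow : {A : Set} → (A → A → A) → A → A → ℕ → A
pow _·_ e y zero    = e
pow _·_ e y (suc n) = y · pow _·_ e y n

record TQModel : Set₁ where
  field
    Carrier : Set
    _<_     : Carrier → Carrier → Set
    _·_     : Carrier → Carrier → Carrier
    _⁻¹     : Carrier → Carrier
    𝟏       : Carrier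

  infix 4 _<_
  infixl 7 _·_
  infixr 8 _^_
  _^_ : Carrier → ℕ → Carrier
  y ^ n = pow _·_ 𝟏 y n

  ℜ : ℕ → Carrier → Set
  ℜ n w = ∃[ v ] (w ≡ v ^ n)

  field
    O1 : ∀ x y → x < y → ¬ (y < x)
    O2 : ∀ x y z → x < y → y < z → x < z
    O3 : ∀ x y → (x < y) ⊎ ((x ≡ y) ⊎ (y < x))
    M1 : ∀ x y z → x · (y · z) ≡ (x · y) · z
    M2 : ∀ x → x · 𝟏 ≡ x
    M3 : ∀ x → x · (x ⁻¹) ≡ 𝟏
    M4 : ∀ x y → x · y ≡ y · x
    M5 : ∀ x y z → x < y → x · z < y · z
    M6 : ∃[ y ] (y ≢ 𝟏)
    M10 : ∀ (n : ℕ) → 1 Data.Nat.≤ n → ∀ x z → ∃[ y ] (x < z → (x < y ^ n) × (y ^ n < z))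
    M11 : ∀ (n q : ℕ) → 1 Data.Nat.≤ n → 1 Data.Nat.≤ q →
          (m : Fin q → ℕ) → (∀ j → 1 <ℕ m j) →
          (x : Fin q → Carrier) →
          ∃[ y ] (∀ z → ∀ (j : Fin q) → ¬ (m j ∣ n) → y ^ n · x j ≢ z ^ m j)

-- Given x < z, (M10) yields v with x · u < vⁿ < z · u; then y = vⁿ · u⁻¹ lies
-- strictly between x and z, since translation by u⁻¹ preserves <, and
-- y · u = vⁿ.  The one-sided versions follow because the order has no
-- endpoints: some b exceeds 𝟏 (by (M6), passing to the inverse if needed), so
-- b⁻¹ · z < z < b · z.  The first sentence is trivial: take y = u⁻¹.
module Submission where

open import Defs
open import Data.Nat using (ℕ; zero; suc) renaming (_<_ to _<ℕ_; _≤_ to _≤ℕ_)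
open import Data.Nat.Properties using (<⇒≤)
open import Data.Product using (∃-syntax; _×_; _,_)
open import Data.Sum using (inj₁; inj₂)
open import Data.Empty using (⊥-elim)
open import Relation.Binary.PropositionalEquality using (_≡_; refl; sym; trans; cong; subst; module ≡-Reasoning)

module TQProperties (M : TQModel) where
  open TQModel M
  open ≡-Reasoning

  ·-identityˡ : ∀ x → 𝟏 · x ≡ x
  ·-identityˡ x = trans (M4 𝟏 x) (M2 x)

  ⁻¹-inverseˡ : ∀ x → x ⁻¹ · x ≡ 𝟏
  ⁻¹-inverseˡ x = trans (M4 (x ⁻¹) x) (M3 x)

  ·-⁻¹-cancelʳ : ∀ w u → w · u · u ⁻¹ ≡ w
  ·-⁻¹-cancelʳ w u = begin
    w · u · u ⁻¹   ≡⟨ sym (M1 w u (u ⁻¹)) ⟩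
    w · (u · u ⁻¹) ≡⟨ cong (w ·_) (M3 u) ⟩
    w · 𝟏          ≡⟨ M2 w ⟩
    w              ∎

  ⁻¹-·-cancelʳ : ∀ w u → w · u ⁻¹ · u ≡ w
  ⁻¹-·-cancelʳ w u = begin
    w · u ⁻¹ · u   ≡⟨ sym (M1 w (u ⁻¹) u) ⟩
    w · (u ⁻¹ · u) ≡⟨ cong (w ·_) (⁻¹-inverseˡ u) ⟩
    w · 𝟏          ≡⟨ M2 w ⟩
    w              ∎

  𝟏^ : ∀ n → 𝟏 ^ n ≡ 𝟏
  𝟏^ zero    = refl
  𝟏^ (suc n) = trans (cong (𝟏 ·_) (𝟏^ n)) (M2 𝟏)

  ℜ-𝟏 : ∀ n → ℜ n 𝟏
  ℜ-𝟏 n = 𝟏 , sym (𝟏^ n)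

  <-shiftʳ : ∀ {x w} u → x · u < w → x < w · u ⁻¹
  <-shiftʳ {x} {w} u p = subst (_< w · u ⁻¹) (·-⁻¹-cancelʳ x u) (M5 _ _ (u ⁻¹) p)

  >-shiftʳ : ∀ {w z} u → w < z · u → w · u ⁻¹ < z
  >-shiftʳ {w} {z} u p = subst (w · u ⁻¹ <_) (·-⁻¹-cancelʳ z u) (M5 _ _ (u ⁻¹) p)

  <𝟏⇒𝟏<⁻¹ : ∀ {a} → a < 𝟏 → 𝟏 < a ⁻¹
  <𝟏⇒𝟏<⁻¹ {a} p = subst (_< a ⁻¹) (M3 a) (subst (a · a ⁻¹ <_) (·-identityˡ (a ⁻¹)) (M5 a 𝟏 (a ⁻¹) p))

  𝟏<⇒⁻¹<𝟏 : ∀ {b} → 𝟏 < b → b ⁻¹ < 𝟏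
  𝟏<⇒⁻¹<𝟏 {b} p = subst (b ⁻¹ <_) (M3 b) (subst (_< b · b ⁻¹) (·-identityˡ (b ⁻¹)) (M5 𝟏 b (b ⁻¹) p))

  ∃𝟏< : ∃[ b ] (𝟏 < b)
  ∃𝟏< with M6
  ... | a , a≢𝟏 with O3 𝟏 a
  ... | inj₁ 𝟏<a        = a , 𝟏<a
  ... | inj₂ (inj₁ 𝟏≡a) = ⊥-elim (a≢𝟏 (sym 𝟏≡a))
  ... | inj₂ (inj₂ a<𝟏) = a ⁻¹ , <𝟏⇒𝟏<⁻¹ a<𝟏

  𝟏<⇒<· : ∀ {b} x → 𝟏 < b → x < b · x
  𝟏<⇒<· {b} x p = subst (_< b · x) (·-identityˡ x) (M5 𝟏 b x p)

  <𝟏⇒·< : ∀ {a} z → a < 𝟏 → a · z < z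
  <𝟏⇒·< {a} z p = subst (a · z <_) (·-identityˡ z) (M5 a 𝟏 z p)

  no-maximum : ∀ x → ∃[ z ] (x < z)
  no-maximum x with ∃𝟏<
  ... | b , 𝟏<b = b · x , 𝟏<⇒<· x 𝟏<b

  no-minimum : ∀ z → ∃[ x ] (x < z)
  no-minimum z with ∃𝟏<
  ... | b , 𝟏<b = b ⁻¹ · z , <𝟏⇒·< z (𝟏<⇒⁻¹<𝟏 𝟏<b)

  ℜ-translate-dense : ∀ n → 1 ≤ℕ n → ∀ x z u →
                      ∃[ y ] (x < z → (x < y) × (y < z) × ℜ n (y · u))
  ℜ-translate-dense n n≥1 x z u with M10 n n≥1 (x · u) (z · u)
  ... | v , between = v ^ n · u ⁻¹ , λ x<z →
    let (xu<vⁿ , vⁿ<zu) = between (M5 x z u x<z) in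
    <-shiftʳ u xu<vⁿ , >-shiftʳ u vⁿ<zu , v , ⁻¹-·-cancelʳ (v ^ n) u

lemma3 : (M : TQModel) → let open TQModel M in
    (n : ℕ) → 1 <ℕ n →
      (∀ u → ∃[ y ] ℜ n (y · u))
    × (∀ x u → ∃[ y ] ((x < y) × ℜ n (y · u)))
    × (∀ z u → ∃[ y ] ((y < z) × ℜ n (y · u)))
    × (∀ x z u → ∃[ y ] (x < z → (x < y) × (y < z) × ℜ n (y · u)))
lemma3 M n n>1 = root , above , below , dense
  where
  open TQModel M
  open TQProperties M

  dense : ∀ x z u → ∃[ y ] (x < z → (x < y) × (y < z) × ℜ n (y · u))
  dense = ℜ-translate-dense n (<⇒≤ n>1)

  root : ∀ u → ∃[ y ] ℜ n (y · u)
  root u = u ⁻¹ , subst (ℜ n) (sym (⁻¹-inverseˡ u)) (ℜ-𝟏 n)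

  above : ∀ x u → ∃[ y ] ((x < y) × ℜ n (y · u))
  above x u with no-maximum x
  ... | z , x<z with dense x z u
  ... | y , f with f x<z
  ... | x<y , _ , ℜy = y , x<y , ℜy

  below : ∀ z u → ∃[ y ] ((y < z) × ℜ n (y · u))
  below z u with no-minimum z
  ... | x , x<z with dense x z u
  ... | y , f with f x<z
  ... | _ , y<z , ℜy = y , y<z , ℜy
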